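{- If $C=(a_{i_1} \; a_{i_2} \; a_{i_3} \; \dots \; a_{i_{2k}})$ and $C'=(a_{i_1} \; a_{i_2} \; a_{i_3}' \; \dots \; a_{i_{2l}}')$ are both even cycles of $I$, then $k=l$ and $a_{i_j} = a_{i_j}'$ for $3\leq j\leq 2k$.
   Context: $I=(A,\succ)$ is an SR (Stable Roommates) instance with an even number of agents and strict complete preference lists. A stable partition is a permutation $\Pi$ of $A$ such that (T1) every agent weakly prefers its successor to its predecessor, and (T2) no two distinct agents $a_i,a_j$ satisfy $a_j \succ_i \Pi^{ -1}(a_i)$ and $a_i \succ_j \Pi^{ -1}(a_j)$. An even cycle of $I$ is a cycle of even length greater than 2 that belongs to some stable partition of $I$. The lemma says that a predecessor–successor pair $(a_{i_1}, a_{i_2})$ determines at most one even cycle. -}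

module Defs where

open import Data.Nat using (ℕ; _≤_; _<_; _*_)
open import Data.Nat.Properties using ()
open import Data.Fin using (Fin)
open import Data.Fin.Permutation using (Permutation′; _⟨$⟩ʳ_; _⟨$⟩ˡ_)
open import Data.List using (List; []; _∷_; length)
open import Data.List.Relation.Unary.Unique.Propositional using (Unique)
open import Data.Product using (_×_; ∃)
open import Data.Unit using (⊤)
open import Data.Empty using (⊥)
open import Relation.Binary.PropositionalEquality using (_≡_; _≢_)
open import Relation.Nullary using (¬_)

-- Preferences of agent i are encoded by a rank function  rank i : Fin n → ℕ
-- (smaller rank = more preferred).  Injectivity makes each list strict and
-- complete; agent i ranks itself last (being "matched with oneself" is the
-- worst outcome), the standard convention for stable partitions.
record SRInstance (n : ℕ) : Set where
  field
    rank     : Fin n → Fin n → ℕ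
    rank-inj : ∀ i j j′ → rank i j ≡ rank i j′ → j ≡ j′
    self-last : ∀ i j → rank i j ≤ rank i i

open SRInstance public

Prefers : ∀ {n} → SRInstance n → Fin n → Fin n → Fin n → Set
Prefers I i j k = rank I i j < rank I i k

WeaklyPrefers : ∀ {n} → SRInstance n → Fin n → Fin n → Fin n → Set
WeaklyPrefers I i j k = rank I i j ≤ rank I i k

-- Stable partition: a permutation Π of A with (T1) and (T2).
-- Π ⟨$⟩ʳ a is the successor of a, Π ⟨$⟩ˡ a its predecessor.
record IsStablePartition {n : ℕ} (I : SRInstance n) (Π : Permutation′ n) : Set where
  field
    T1 : ∀ i → WeaklyPrefers I i (Π ⟨$⟩ʳ i) (Π ⟨$⟩ˡ i)
    T2 : ∀ i j → i ≢ j →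
         ¬ (Prefers I i j (Π ⟨$⟩ˡ i) × Prefers I j i (Π ⟨$⟩ˡ j))

CycleChain : ∀ {n} → Permutation′ n → Fin n → List (Fin n) → Set
CycleChain Π h [] = ⊤
CycleChain Π h (y ∷ []) = Π ⟨$⟩ʳ y ≡ h
CycleChain Π h (y ∷ z ∷ zs) = (Π ⟨$⟩ʳ y ≡ z) × CycleChain Π h (z ∷ zs)

IsCycleOf : ∀ {n} → Permutation′ n → List (Fin n) → Set
IsCycleOf Π [] = ⊥
IsCycleOf Π (x ∷ xs) = Unique (x ∷ xs) × CycleChain Π x (x ∷ xs)

IsEvenCycle : ∀ {n} → SRInstance n → List (Fin n) → Set
IsEvenCycle {n} I C =
  (∃ λ k → length C ≡ 2 * k) × 2 < length C ×
  ∃ λ (Π : Permutation′ n) → IsStablePartition I Π × IsCycleOf Π C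

{-# OPTIONS --safe #-}
module Submission where

-- Walking along both cycles, it suffices to show: if x → y in two stable partitions Π and Π′,
-- and neither sends y back to x, then Π y = Π′ y. Suppose y strictly prefers Π y to Π′ y.
-- Stability of both partitions shows that the set of agents strictly preferring their
-- Π-successor to their Π′-successor is closed under x ↦ Π′⁻¹ (Π x); by finiteness it is then
-- closed under the inverse map as well. But stability also shows that Π⁻¹ (Π′ y) is not in
-- that set although y is.

open import Defs
open import Data.Nat using (ℕ; zero; suc; _*_; _+_; _<_; s≤s)
open import Data.Nat.Properties
  using (<-irrefl; <⇒≱; <-≤-trans; ≮⇒≥; ≤∧≢⇒<; <-cmp; +-suc; n<1+n; m≤n⇒∃[o]m+o≡n; *-cancelˡ-≡)
open import Data.Nat.GeneralisedArithmetic using (fold; fold-+)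
open import Data.Fin using (Fin; toℕ; _≟_)
open import Data.Fin.Properties using (pigeonhole)
open import Data.Fin.Permutation
  using (Permutation′; _⟨$⟩ʳ_; _⟨$⟩ˡ_; inverseˡ; inverseʳ; flip; _∘ₚ_)
open import Data.List using (List; []; _∷_; length)
open import Data.List.Relation.Unary.All using (_∷_)
open import Data.List.Relation.Unary.AllPairs using (_∷_)
open import Data.List.Relation.Unary.Unique.Propositional using (Unique)
open import Data.Product using (_×_; _,_; ∃)
open import Data.Empty using (⊥; ⊥-elim)
open import Function using (_∘_)
open import Relation.Nullary using (¬_; yes; no)
open import Relation.Binary.PropositionalEquality
  using (_≡_; _≢_; refl; sym; trans; cong; subst; module ≡-Reasoning)
open import Relation.Binary.Definitions using (tri<; tri≈; tri>)

open IsStablePartition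

fold-injective : ∀ {A : Set} {s : A → A} → (∀ {a b} → s a ≡ s b → a ≡ b) →
                 ∀ i {a b} → fold a s i ≡ fold b s i → a ≡ b
fold-injective s-inj zero    eq = eq
fold-injective s-inj (suc i) eq = fold-injective s-inj i (s-inj eq)

Unique-drop₂ : ∀ {A : Set} {x y : A} {zs} → Unique (x ∷ y ∷ zs) → Unique (x ∷ zs)
Unique-drop₂ ((_ ∷ x∉zs) ∷ _ ∷ zs-unique) = x∉zs ∷ zs-unique

module _ {n : ℕ} (π : Permutation′ n) where

  ⟨$⟩ʳ⇒⟨$⟩ˡ : ∀ {x y} → π ⟨$⟩ʳ x ≡ y → π ⟨$⟩ˡ y ≡ x
  ⟨$⟩ʳ⇒⟨$⟩ˡ refl = inverseˡ π

  ⟨$⟩ˡ⇒⟨$⟩ʳ : ∀ {x y} → π ⟨$⟩ˡ y ≡ x → π ⟨$⟩ʳ x ≡ y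
  ⟨$⟩ˡ⇒⟨$⟩ʳ refl = inverseʳ π

  ⟨$⟩ʳ-injective : ∀ {x y} → π ⟨$⟩ʳ x ≡ π ⟨$⟩ʳ y → x ≡ y
  ⟨$⟩ʳ-injective eq = trans (sym (⟨$⟩ʳ⇒⟨$⟩ˡ eq)) (inverseˡ π)

  πⁿ : Fin n → ℕ → Fin n
  πⁿ x = fold x (π ⟨$⟩ʳ_)

  return⇒⟨$⟩ˡ-iterate : ∀ {x} i d → πⁿ x i ≡ πⁿ x (i + suc d) → π ⟨$⟩ˡ x ≡ πⁿ x d
  return⇒⟨$⟩ˡ-iterate {x} i d eq = ⟨$⟩ʳ⇒⟨$⟩ˡ (sym x≡πᵈ⁺¹x)
    where
    x≡πᵈ⁺¹x : x ≡ πⁿ x (suc d)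
    x≡πᵈ⁺¹x = fold-injective ⟨$⟩ʳ-injective i (trans eq (fold-+ x (π ⟨$⟩ʳ_) i))

  ⟨$⟩ˡ-iterate : ∀ x → ∃ λ d → π ⟨$⟩ˡ x ≡ πⁿ x d
  ⟨$⟩ˡ-iterate x
    with i , j , i<j , πⁱx≡πʲx ← pigeonhole (n<1+n n) (πⁿ x ∘ toℕ)
    with d , i+1+d≡j ← m≤n⇒∃[o]m+o≡n i<j
    = d , return⇒⟨$⟩ˡ-iterate (toℕ i) d (begin
        πⁿ x (toℕ i)           ≡⟨ πⁱx≡πʲx ⟩
        πⁿ x (toℕ j)           ≡⟨ cong (πⁿ x) (sym i+1+d≡j) ⟩
        πⁿ x (suc (toℕ i + d)) ≡⟨ cong (πⁿ x) (sym (+-suc (toℕ i) d)) ⟩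
        πⁿ x (toℕ i + suc d)   ∎)
    where open ≡-Reasoning

  closed⇒closedˡ : (P : Fin n → Set) → (∀ {x} → P x → P (π ⟨$⟩ʳ x)) →
                   ∀ {x} → P x → P (π ⟨$⟩ˡ x)
  closed⇒closedˡ P closed {x} px with d , eq ← ⟨$⟩ˡ-iterate x = subst P (sym eq) (iterates d)
    where
    iterates : ∀ d → P (πⁿ x d)
    iterates zero    = px
    iterates (suc d) = closed (iterates d)

  chain-successor≢ : ∀ {h y z zs} → CycleChain π h (z ∷ zs) → Unique (h ∷ y ∷ z ∷ zs) →
                     π ⟨$⟩ʳ z ≢ y
  chain-successor≢ {zs = []} πz≡h ((h≢y ∷ _) ∷ _) πz≡y =
    h≢y (trans (sym πz≡h) πz≡y)
  chain-successor≢ {zs = w ∷ _} (πz≡w , _) (_ ∷ (_ ∷ y≢w ∷ _) ∷ _) πz≡y =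
    y≢w (trans (sym πz≡y) πz≡w)

  long-cycle⇒¬2-cycle : ∀ {a b rest} → IsCycleOf π (a ∷ b ∷ rest) → 2 < length (a ∷ b ∷ rest) →
                        π ⟨$⟩ʳ b ≢ a
  long-cycle⇒¬2-cycle {rest = []} _ (s≤s (s≤s ()))
  long-cycle⇒¬2-cycle {rest = z ∷ _} ((_ ∷ a≢z ∷ _) ∷ _ , _ , πb≡z , _) _ πb≡a =
    a≢z (trans (sym πb≡a) πb≡z)

module _ {n : ℕ} (I : SRInstance n) where

  weakly-prefers∧≢⇒prefers : ∀ {i j k} → WeaklyPrefers I i j k → j ≢ k → Prefers I i j k
  weakly-prefers∧≢⇒prefers {i} {j} {k} ≼ j≢k = ≤∧≢⇒< ≼ (j≢k ∘ rank-inj I i j k)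

  ¬prefers∧≢⇒prefers : ∀ {i j k} → ¬ Prefers I i j k → k ≢ j → Prefers I i k j
  ¬prefers∧≢⇒prefers ¬≺ = weakly-prefers∧≢⇒prefers (≮⇒≥ ¬≺)

  module _ {Π : Permutation′ n} (st : IsStablePartition I Π) where

    T1-strict : ∀ {i} → Π ⟨$⟩ʳ i ≢ Π ⟨$⟩ˡ i → Prefers I i (Π ⟨$⟩ʳ i) (Π ⟨$⟩ˡ i)
    T1-strict = weakly-prefers∧≢⇒prefers (T1 st _)

    no-blocking-pair : ∀ {i j} → Prefers I i j (Π ⟨$⟩ˡ i) → Prefers I j i (Π ⟨$⟩ˡ j) → ⊥
    no-blocking-pair {i} {j} i≺ j≺ with i ≟ j
    ... | yes refl = <⇒≱ i≺ (self-last I i (Π ⟨$⟩ˡ i))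
    ... | no i≢j   = T2 st i j i≢j (i≺ , j≺)

    no-blocking-pairʳ : ∀ {i j} → Prefers I i j (Π ⟨$⟩ʳ i) → Prefers I j i (Π ⟨$⟩ˡ j) → ⊥
    no-blocking-pairʳ i≺ = no-blocking-pair (<-≤-trans i≺ (T1 st _))

  module Comparison {Π Π′ : Permutation′ n}
                    (st : IsStablePartition I Π) (st′ : IsStablePartition I Π′) where

    PrefersFirst : Fin n → Set
    PrefersFirst i = Prefers I i (Π ⟨$⟩ʳ i) (Π′ ⟨$⟩ʳ i)

    -- φ ⟨$⟩ʳ x = Π′ ⟨$⟩ˡ (Π ⟨$⟩ʳ x):  _∘ₚ_ composes left to right.
    φ : Permutation′ n
    φ = Π ∘ₚ flip Π′

    PrefersFirst-φ : ∀ {x} → PrefersFirst x → PrefersFirst (φ ⟨$⟩ʳ x)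
    PrefersFirst-φ {x} x-prefers-Π =
      subst (Prefers I z (Π ⟨$⟩ʳ z)) (sym (inverseʳ Π′)) z-prefers-Πz
      where
      y = Π ⟨$⟩ʳ x
      z = Π′ ⟨$⟩ˡ y
      z≢x : z ≢ x
      z≢x z≡x = <-irrefl (cong (rank I x) (sym (⟨$⟩ˡ⇒⟨$⟩ʳ Π′ z≡x))) x-prefers-Π
      y-prefers-z : Prefers I y z (Π ⟨$⟩ˡ y)
      y-prefers-z = subst (Prefers I y z) (sym (inverseˡ Π))
                      (¬prefers∧≢⇒prefers (no-blocking-pairʳ st′ x-prefers-Π) z≢x)
      z-prefers-Πz : Prefers I z (Π ⟨$⟩ʳ z) y
      z-prefers-Πz = ¬prefers∧≢⇒prefers
                       (λ z-prefers-y → no-blocking-pairʳ st z-prefers-y y-prefers-z)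
                       (z≢x ∘ ⟨$⟩ʳ-injective Π)

    ¬PrefersFirst-φ⁻¹ : ∀ {b} → Π ⟨$⟩ˡ b ≡ Π′ ⟨$⟩ˡ b → Π′ ⟨$⟩ʳ b ≢ Π′ ⟨$⟩ˡ b →
                        PrefersFirst b → ¬ PrefersFirst (φ ⟨$⟩ˡ b)
    ¬PrefersFirst-φ⁻¹ {b} pred≡ ¬2-cycle′ b-prefers-Π e-prefers-Π =
      no-blocking-pairʳ st′ e-prefers-c c-prefers-e
      where
      c = Π′ ⟨$⟩ʳ b
      e = Π ⟨$⟩ˡ c
      b-prefers-c : Prefers I b c (Π ⟨$⟩ˡ b)
      b-prefers-c = subst (Prefers I b c) (sym pred≡) (T1-strict st′ ¬2-cycle′)
      e≢b : e ≢ b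
      e≢b e≡b = <-irrefl (cong (rank I b) (⟨$⟩ˡ⇒⟨$⟩ʳ Π e≡b)) b-prefers-Π
      c-prefers-e : Prefers I c e (Π′ ⟨$⟩ˡ c)
      c-prefers-e = subst (Prefers I c e) (sym (inverseˡ Π′))
                      (¬prefers∧≢⇒prefers (no-blocking-pair st b-prefers-c) e≢b)
      e-prefers-c : Prefers I e c (Π′ ⟨$⟩ʳ e)
      e-prefers-c = subst (λ w → Prefers I e w (Π′ ⟨$⟩ʳ e)) (inverseʳ Π) e-prefers-Π

    shared-predecessor⇒¬PrefersFirst : ∀ {b} → Π ⟨$⟩ˡ b ≡ Π′ ⟨$⟩ˡ b →
                                       Π′ ⟨$⟩ʳ b ≢ Π′ ⟨$⟩ˡ b → ¬ PrefersFirst b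
    shared-predecessor⇒¬PrefersFirst pred≡ ¬2-cycle′ b-prefers-Π =
      ¬PrefersFirst-φ⁻¹ pred≡ ¬2-cycle′ b-prefers-Π
        (closed⇒closedˡ φ PrefersFirst PrefersFirst-φ b-prefers-Π)

  shared-predecessor⇒shared-successor :
    ∀ {Π Π′ : Permutation′ n} → IsStablePartition I Π → IsStablePartition I Π′ →
    ∀ {y} → Π ⟨$⟩ˡ y ≡ Π′ ⟨$⟩ˡ y → Π ⟨$⟩ʳ y ≢ Π ⟨$⟩ˡ y → Π′ ⟨$⟩ʳ y ≢ Π′ ⟨$⟩ˡ y →
    Π ⟨$⟩ʳ y ≡ Π′ ⟨$⟩ʳ y
  shared-predecessor⇒shared-successor {Π} {Π′} st st′ {y} pred≡ ¬2-cycle ¬2-cycle′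
    with <-cmp (rank I y (Π ⟨$⟩ʳ y)) (rank I y (Π′ ⟨$⟩ʳ y))
  ... | tri≈ _ ranks≡ _ = rank-inj I y _ _ ranks≡
  ... | tri< Π≺Π′ _ _ =
    ⊥-elim (Comparison.shared-predecessor⇒¬PrefersFirst st st′ pred≡ ¬2-cycle′ Π≺Π′)
  ... | tri> _ _ Π′≺Π =
    ⊥-elim (Comparison.shared-predecessor⇒¬PrefersFirst st′ st (sym pred≡) ¬2-cycle Π′≺Π)

  shared-edge⇒shared-successor :
    ∀ {Π Π′ : Permutation′ n} → IsStablePartition I Π → IsStablePartition I Π′ →
    ∀ {x y} → Π ⟨$⟩ʳ x ≡ y → Π′ ⟨$⟩ʳ x ≡ y → Π ⟨$⟩ʳ y ≢ x → Π′ ⟨$⟩ʳ y ≢ x →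
    Π ⟨$⟩ʳ y ≡ Π′ ⟨$⟩ʳ y
  shared-edge⇒shared-successor {Π} {Π′} st st′ {x} {y} Πx≡y Π′x≡y Πy≢x Π′y≢x =
    shared-predecessor⇒shared-successor st st′ (trans Πy-pred (sym Π′y-pred))
      (subst (Π ⟨$⟩ʳ y ≢_) (sym Πy-pred) Πy≢x) (subst (Π′ ⟨$⟩ʳ y ≢_) (sym Π′y-pred) Π′y≢x)
    where
    Πy-pred : Π ⟨$⟩ˡ y ≡ x
    Πy-pred = ⟨$⟩ʳ⇒⟨$⟩ˡ Π Πx≡y
    Π′y-pred : Π′ ⟨$⟩ˡ y ≡ x
    Π′y-pred = ⟨$⟩ʳ⇒⟨$⟩ˡ Π′ Π′x≡y

  module _ {Π Π′ : Permutation′ n} (st : IsStablePartition I Π) (st′ : IsStablePartition I Π′)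
           {h : Fin n} where

    chains-agree : ∀ {x y} xs ys → Π ⟨$⟩ʳ x ≡ y → Π′ ⟨$⟩ʳ x ≡ y → Π ⟨$⟩ʳ y ≢ x → Π′ ⟨$⟩ʳ y ≢ x →
                   CycleChain Π h (y ∷ xs) → CycleChain Π′ h (y ∷ ys) →
                   Unique (h ∷ y ∷ xs) → Unique (h ∷ y ∷ ys) → xs ≡ ys
    chains-agree [] [] _ _ _ _ _ _ _ _ = refl
    chains-agree [] (w ∷ _) Πx Π′x Πy≢x Π′y≢x Πy≡h (Π′y≡w , _) _ ((_ ∷ h≢w ∷ _) ∷ _) =
      ⊥-elim (h≢w (trans (sym Πy≡h) (trans Πy≡Π′y Π′y≡w)))
      where Πy≡Π′y = shared-edge⇒shared-successor st st′ Πx Π′x Πy≢x Π′y≢x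
    chains-agree (z ∷ _) [] Πx Π′x Πy≢x Π′y≢x (Πy≡z , _) Π′y≡h ((_ ∷ h≢z ∷ _) ∷ _) _ =
      ⊥-elim (h≢z (trans (sym Π′y≡h) (trans (sym Πy≡Π′y) Πy≡z)))
      where Πy≡Π′y = shared-edge⇒shared-successor st st′ Πx Π′x Πy≢x Π′y≢x
    chains-agree (z ∷ zs) (w ∷ ws) Πx Π′x Πy≢x Π′y≢x (Πy≡z , chain) (Π′y≡w , chain′)
                 unique unique′
      with refl ← trans (sym Πy≡z) (trans (shared-edge⇒shared-successor st st′ Πx Π′x Πy≢x Π′y≢x)
                                          Π′y≡w)
      = cong (z ∷_) (chains-agree zs ws Πy≡z Π′y≡w
                       (chain-successor≢ Π chain unique) (chain-successor≢ Π′ chain′ unique′)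
                       chain chain′ (Unique-drop₂ unique) (Unique-drop₂ unique′))

lemma26 : ∀ {m : ℕ} (I : SRInstance (2 * m)) (a₁ a₂ : Fin (2 * m))
          (rest rest′ : List (Fin (2 * m))) (k l : ℕ) →
          length (a₁ ∷ a₂ ∷ rest) ≡ 2 * k →
          length (a₁ ∷ a₂ ∷ rest′) ≡ 2 * l →
          IsEvenCycle I (a₁ ∷ a₂ ∷ rest) →
          IsEvenCycle I (a₁ ∷ a₂ ∷ rest′) →
          k ≡ l × rest ≡ rest′
lemma26 I a₁ a₂ rest rest′ k l len≡2k len′≡2l
        (_ , 2<len , Π , st , cycle@(unique , Πa₁≡a₂ , chain))
        (_ , 2<len′ , Π′ , st′ , cycle′@(unique′ , Π′a₁≡a₂ , chain′)) =
  *-cancelˡ-≡ k l 2 2k≡2l , rest≡rest′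
  where
  rest≡rest′ : rest ≡ rest′
  rest≡rest′ = chains-agree I st st′ rest rest′ Πa₁≡a₂ Π′a₁≡a₂
                 (long-cycle⇒¬2-cycle Π cycle 2<len) (long-cycle⇒¬2-cycle Π′ cycle′ 2<len′)
                 chain chain′ unique unique′
  open ≡-Reasoning
  2k≡2l : 2 * k ≡ 2 * l
  2k≡2l = begin
    2 * k                     ≡⟨ sym len≡2k ⟩
    length (a₁ ∷ a₂ ∷ rest)   ≡⟨ cong (λ r → length (a₁ ∷ a₂ ∷ r)) rest≡rest′ ⟩
    length (a₁ ∷ a₂ ∷ rest′)  ≡⟨ len′≡2l ⟩
    2 * l                     ∎
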